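{- For every natural number $j$, $M_0^0(2j+2)\ge 2^j$.
   Context: $K$ is a field. A monomial in $K[X_d,\dots,X_0,Y]$ is a polynomial $X_d^{i_d}\cdots X_0^{i_0}Y^j$, of degree $i_d+\dots+i_0+j$. A monomial ideal is an ideal generated by monomials; the degree of a finite set of monomials is the maximum degree of its elements, and $\mathrm{deg}(I)$ for a monomial ideal $I$ is the minimum degree of a finite set of monomials generating $I$. For natural numbers $d,l$, $M_d^0(l)$ denotes the least $M$ such that for every sequence $I_0,\dots,I_M$ of monomial ideals in $K[X_d,\dots,X_0,Y]$ with $\mathrm{deg}(I_i)\le l$ for all $i\le M$ there exist $i<j\le M$ with $I_i\supseteq I_j$. (So $M_0^0$ concerns ideals in $K[X_0,Y]$.) -}

module Defs where

open import Data.Nat using (ℕ; _+_; _≤_; _⊔_)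
open import Data.Fin using (Fin; _<_)
open import Data.Vec using (Vec; toList)
open import Data.List using (List; map; foldr)
open import Data.Nat.ListAction using (sum)
open import Data.List.Relation.Unary.Any using (Any)
open import Data.Vec.Relation.Binary.Pointwise.Inductive using (Pointwise)
open import Data.Product using (Σ; _×_)

-- A monomial in n variables, given by its exponent vector.
-- K[X_d,…,X_0,Y] has d + 2 variables.
Mon : ℕ → Set
Mon n = Vec ℕ n

degMon : ∀ {n} → Mon n → ℕ
degMon m = sum (toList m)

degSet : ∀ {n} → List (Mon n) → ℕ
degSet G = foldr _⊔_ 0 (map degMon G)

_∣ₘ_ : ∀ {n} → Mon n → Mon n → Set
g ∣ₘ m = Pointwise _≤_ g m

-- A monomial ideal is represented by a finite list of monomial generators;
-- the monomial m lies in the ideal ⟨ G ⟩ iff some generator divides it.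
_∈⟨_⟩ : ∀ {n} → Mon n → List (Mon n) → Set
m ∈⟨ G ⟩ = Any (λ g → g ∣ₘ m) G

-- containment of monomial ideals ⟨ G ⟩ ⊇ ⟨ H ⟩ (a monomial ideal is determined by
-- the monomials it contains)
_⊇ᴵ_ : ∀ {n} → List (Mon n) → List (Mon n) → Set
G ⊇ᴵ H = ∀ m → m ∈⟨ H ⟩ → m ∈⟨ G ⟩

-- The defining property of M_d^0(l): every sequence I_0,…,I_M of monomial ideals in
-- K[X_d,…,X_0,Y] of degree ≤ l has i < j ≤ M with I_i ⊇ I_j.
-- An ideal has deg ≤ l iff it has a finite monomial generating set of degree ≤ l,
-- so we quantify over such generating sets.
GoodBound : (d l M : ℕ) → Set
GoodBound d l M =
  (I : Fin (Data.Nat.suc M) → List (Mon (d + 2))) →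
  (∀ i → degSet (I i) ≤ l) →
  Σ (Fin (Data.Nat.suc M)) λ i → Σ (Fin (Data.Nat.suc M)) λ j → (i < j) × (I i ⊇ᴵ I j)

{-# OPTIONS --safe #-}
-- The monomials X₀^b Y^(c-b), b ≤ c, have degree c and are pairwise incomparable under
-- divisibility, so ideals generated by sets of them contain one another exactly when the
-- sets do. Let I_n be generated by the X₀^b Y^(c-b) with b the position of a binary digit 1
-- of n. If I_i ⊇ I_k, the 1-digits of k are among those of i, so k ≤ i. Hence
-- I_0, …, I_(2^c - 1) is a bad sequence of degree c, and we take c = j ≤ 2j + 2.
module Submission where

open import Defs
open import Data.Nat using (ℕ; zero; suc; _+_; _*_; _^_; _∸_; _≤_; _<_; z≤n; s≤s; _<?_)
open import Data.Nat.Properties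
open import Data.Fin using (toℕ)
open import Data.Fin.Properties using (toℕ<n)
open import Data.Vec using ([]; _∷_)
open import Data.Vec.Relation.Binary.Pointwise.Inductive as Pointwise using (_∷_)
open import Data.List as List using (List; []; _∷_)
open import Data.List.Membership.Propositional using (_∈_)
open import Data.List.Relation.Binary.Subset.Propositional using (_⊆_)
open import Data.List.Relation.Unary.All as All using (All; []; _∷_)
open import Data.List.Relation.Unary.All.Properties as All using ()
open import Data.List.Relation.Unary.Any as Any using (here; there)
open import Data.List.Relation.Unary.Any.Properties as Any using ()
open import Data.List.Properties using (foldr-preservesᵇ)
open import Data.Product using (_,_)
open import Function using (_∘_)
open import Relation.Nullary using (yes; no; ¬_; contradiction)
open import Relation.Binary.PropositionalEquality using (_≡_; refl; sym; trans; cong)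

antichain : ℕ → ℕ → Mon 2
antichain c b = b ∷ (c ∸ b) ∷ []

degMon-antichain : ∀ {c b} → b ≤ c → degMon (antichain c b) ≡ c
degMon-antichain {c} {b} b≤c = trans (cong (b +_) (+-identityʳ (c ∸ b))) (m+[n∸m]≡n b≤c)

antichain-∣ₘ⇒≡ : ∀ {c a b} → b ≤ c → antichain c a ∣ₘ antichain c b → a ≡ b
antichain-∣ₘ⇒≡ b≤c (a≤b ∷ c∸a≤c∸b ∷ _) = ≤-antisym a≤b (∸-cancelʳ-≤ b≤c c∸a≤c∸b)

antichain-∈⟨⟩⇒∈ : ∀ {c b S} → b ≤ c → antichain c b ∈⟨ List.map (antichain c) S ⟩ → b ∈ S
antichain-∈⟨⟩⇒∈ b≤c mem = Any.map (sym ∘ antichain-∣ₘ⇒≡ b≤c) (Any.map⁻ mem)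

∈⇒antichain-∈⟨⟩ : ∀ {c b S} → b ∈ S → antichain c b ∈⟨ List.map (antichain c) S ⟩
∈⇒antichain-∈⟨⟩ b∈S = Any.map⁺ (Any.map (λ { refl → Pointwise.refl ≤-refl }) b∈S)

antichain-⊇ᴵ⇒⊇ : ∀ {c S T} → All (_≤ c) T →
                 List.map (antichain c) S ⊇ᴵ List.map (antichain c) T → T ⊆ S
antichain-⊇ᴵ⇒⊇ T≤c S⊇T b∈T =
  antichain-∈⟨⟩⇒∈ (All.lookup T≤c b∈T) (S⊇T _ (∈⇒antichain-∈⟨⟩ b∈T))

degSet-≤ : ∀ {n l} {G : List (Mon n)} → All (λ g → degMon g ≤ l) G → degSet G ≤ l
degSet-≤ {l = l} G≤l = foldr-preservesᵇ {P = _≤ l} ⊔-lub z≤n (All.map⁺ G≤l)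

degSet-antichain : ∀ {c S} → All (_≤ c) S → degSet (List.map (antichain c) S) ≤ c
degSet-antichain S≤c = degSet-≤ (All.map⁺ (All.map (≤-reflexive ∘ degMon-antichain) S≤c))

ones : ℕ → ℕ → List ℕ
ones zero    n = []
ones (suc f) n with n <? 2 ^ f
... | yes _ = ones f n
... | no  _ = f ∷ ones f (n ∸ 2 ^ f)

ones-< : ∀ f n → All (_< f) (ones f n)
ones-< zero    n = []
ones-< (suc f) n with n <? 2 ^ f
... | yes _ = All.map m<n⇒m<1+n (ones-< f n)
... | no  _ = n<1+n f ∷ All.map m<n⇒m<1+n (ones-< f (n ∸ 2 ^ f))

ones-⊆⇒≤ : ∀ f {i k} → k < 2 ^ f → ones f k ⊆ ones f i → k ≤ i
ones-⊆⇒≤ zero {k = zero} _ _ = z≤n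
ones-⊆⇒≤ zero {k = suc _} (s≤s ()) _
ones-⊆⇒≤ (suc f) {i} {k} k<2^[1+f] k⊆i with i <? 2 ^ f | k <? 2 ^ f
... | yes _  | yes k< = ones-⊆⇒≤ f k< k⊆i
... | no  i≮ | yes k< = ≤-trans (<⇒≤ k<) (≮⇒≥ i≮)
... | yes _  | no  _  = contradiction (All.lookup (ones-< f i) (k⊆i (here refl))) (<-irrefl refl)
... | no  i≮ | no  k≮ = begin
    k                   ≤⟨ m≤n+m∸n k p ⟩
    p + (k ∸ p)         ≤⟨ +-monoʳ-≤ p (ones-⊆⇒≤ f k∸p<p tail⊆tail) ⟩
    p + (i ∸ p)         ≡⟨ m+[n∸m]≡n (≮⇒≥ i≮) ⟩
    i                   ∎
  where
  open ≤-Reasoning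
  p : ℕ
  p = 2 ^ f

  k∸p<p : k ∸ p < p
  k∸p<p = begin-strict
    k ∸ p               <⟨ ∸-monoˡ-< k<2^[1+f] (≮⇒≥ k≮) ⟩
    p + (p + 0) ∸ p     ≡⟨ m+n∸m≡n p (p + 0) ⟩
    p + 0               ≡⟨ +-identityʳ p ⟩
    p                   ∎

  tail⊆tail : ones f (k ∸ p) ⊆ ones f (i ∸ p)
  tail⊆tail x∈ with k⊆i (there x∈)
  ... | here refl = contradiction (All.lookup (ones-< f (k ∸ p)) x∈) (<-irrefl refl)
  ... | there x∈′ = x∈′

binaryIdeal : ℕ → ℕ → List (Mon 2)
binaryIdeal c n = List.map (antichain c) (ones c n)

degSet-binaryIdeal : ∀ c n → degSet (binaryIdeal c n) ≤ c
degSet-binaryIdeal c n = degSet-antichain (All.map <⇒≤ (ones-< c n))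

binaryIdeal-⊇ᴵ⇒≤ : ∀ c {i k} → k < 2 ^ c → binaryIdeal c i ⊇ᴵ binaryIdeal c k → k ≤ i
binaryIdeal-⊇ᴵ⇒≤ c {k = k} k<2^c Iᵢ⊇Iₖ =
  ones-⊆⇒≤ c k<2^c (antichain-⊇ᴵ⇒⊇ (All.map <⇒≤ (ones-< c k)) Iᵢ⊇Iₖ)

GoodBound-antitone : ∀ {d l l′ M} → l′ ≤ l → GoodBound d l M → GoodBound d l′ M
GoodBound-antitone l′≤l good I deg≤l′ = good I (λ n → ≤-trans (deg≤l′ n) l′≤l)

¬GoodBound-<2^ : ∀ {c M} → M < 2 ^ c → ¬ GoodBound 0 c M
¬GoodBound-<2^ {c} {M} M<2^c good
  with good (binaryIdeal c ∘ toℕ) (degSet-binaryIdeal c ∘ toℕ)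
... | i , k , i<k , Iᵢ⊇Iₖ = <⇒≱ i<k (binaryIdeal-⊇ᴵ⇒≤ c k<2^c Iᵢ⊇Iₖ)
  where
  k<2^c : toℕ k < 2 ^ c
  k<2^c = <-≤-trans (toℕ<n k) M<2^c

mainTheorem6 : (j M : ℕ) → GoodBound 0 (2 * j + 2) M → 2 ^ j ≤ M
mainTheorem6 j M good =
  ≮⇒≥ λ M<2^j → ¬GoodBound-<2^ M<2^j (GoodBound-antitone {d = 0} j≤2j+2 good)
  where
  j≤2j+2 : j ≤ 2 * j + 2
  j≤2j+2 = ≤-trans (m≤m+n j (j + 0)) (m≤m+n (2 * j) 2)
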